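{- Let $T$ be a maximally reduced MUL-tree. Then every internal edge of $T$ resolves a quartet that is resolved by no other edge of $T$.
   Context: A MUL-tree is a triple $(T,M,\psi)$, where $T$ is an unrooted tree with leaf set $\mathcal{L}(T)$ all of whose internal (non-leaf) nodes have degree at least three, $M$ is a finite set of labels, and $\psi:\mathcal{L}(T)\to M$ is a surjective map assigning a label to each leaf; we refer to it simply by $T$. An edge $(u,v)$ is internal if neither $u$ nor $v$ is a leaf. For an edge $(u,v)$ of $T$, deleting $(u,v)$ leaves two subtrees: $T_u^{uv}$ (containing $u$) and $T_v^{uv}$ (containing $v$). $M_u^{uv}$ is the set of labels appearing on leaves of $T_u^{uv}$ but on no leaf of $T_v^{uv}$; $M_v^{uv}$ is defined symmetrically. A (resolved) quartet of $T$ is an (unordered) bipartition $ab|cd$ of a set $\{a,b,c,d\}$ of four distinct labels such that some edge $(u,v)$ of $T$ has $\{a,b\}\subseteq M_u^{uv}$ and $\{c,d\}\subseteq M_v^{uv}$; such an edge is said to resolve $ab|cd$. $\Delta(u,v)$ is the set of quartets resolved by $(u,v)$, and $\mathcal{I}(T)=\bigcup_{(u,v)\in E(T)}\Delta(u,v)$ is the information content of $T$. Operations: Prune$(v)$ for a leaf $v$ deletes $v$ (the label set becomes the set of labels of the remaining leaves); if the neighbor $u$ of $v$ thereby has degree two, the two remaining neighbors of $u$ are joined by an edge and $u$ is deleted. Contract$(e)$ for an internal edge $e$ deletes $e$ and identifies its endpoints. A leaf is prunable if pruning it yields a tree with the same information content as $T$; an internal edge is contractible if contracting it yields a tree with the same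 information content as $T$. $T$ is maximally reduced if it has no prunable leaf and no contractible internal edge. -}

module Defs where

open import Data.Nat using (ℕ; _≤_; _≡ᵇ_)
open import Data.Bool using (Bool; true; false; _∧_; _∨_; not; if_then_else_)
open import Data.Fin using (Fin; _≟_)
open import Data.List using (List; allFin; map)
open import Data.Nat.ListAction using (sum)
open import Data.Bool.ListAction using (any)
open import Data.Product using (Σ; ∃; ∃-syntax; _×_; _,_)
open import Data.Sum using (_⊎_)
open import Relation.Binary.PropositionalEquality using (_≡_; _≢_)
open import Relation.Nullary using (¬_)
open import Relation.Nullary.Decidable using (⌊_⌋)
open import Function.Bundles using (_⇔_)

-- Deleted vertices (after Prune / Contract) are kept as isolated
-- vertices: they lie in no subtree of any edge, so they never
-- contribute labels to quartets.

record LGraph (n m : ℕ) : Set where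
  field
    adj : Fin n → Fin n → Bool
    lab : Fin n → Fin m            -- ψ (only its values on leaves matter)
open LGraph public

_=ᶠ_ : ∀ {n} → Fin n → Fin n → Bool
a =ᶠ b = ⌊ a ≟ b ⌋

Edge : ∀ {n m} → LGraph n m → Fin n → Fin n → Set
Edge G u v = adj G u v ≡ true

deg : ∀ {n m} → LGraph n m → Fin n → ℕ
deg {n} G v = sum (map (λ w → if adj G v w then 1 else 0) (allFin n))

-- a leaf is a vertex of degree one (or the unique vertex of a one-vertex tree)
IsLeaf : ∀ {n m} → LGraph n m → Fin n → Set
IsLeaf G v = deg G v ≤ 1

data Walk {n : ℕ} (E : Fin n → Fin n → Set) : Fin n → Fin n → Set where
  here : ∀ {x} → Walk E x x
  step : ∀ {x y z} → E x y → Walk E y z → Walk E x z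

EdgeWithout : ∀ {n m} → LGraph n m → Fin n → Fin n → Fin n → Fin n → Set
EdgeWithout G u v a b = Edge G a b × ¬ (a ≡ u × b ≡ v) × ¬ (a ≡ v × b ≡ u)

-- w is a vertex of T_u^{uv}: reachable from u after deleting the edge (u,v)
InSub : ∀ {n m} → LGraph n m → Fin n → Fin n → Fin n → Set
InSub G u v w = Walk (EdgeWithout G u v) u w

LabelIn : ∀ {n m} → LGraph n m → Fin n → Fin n → Fin m → Set
LabelIn G u v ℓ = ∃[ w ] (InSub G u v w × IsLeaf G w × lab G w ≡ ℓ)

InM : ∀ {n m} → LGraph n m → Fin n → Fin n → Fin m → Set
InM G u v ℓ = LabelIn G u v ℓ × ¬ LabelIn G v u ℓ

Distinct4 : ∀ {m} → Fin m → Fin m → Fin m → Fin m → Set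
Distinct4 a b c d = a ≢ b × a ≢ c × a ≢ d × b ≢ c × b ≢ d × c ≢ d

Resolves : ∀ {n m} → LGraph n m → Fin n → Fin n →
           Fin m → Fin m → Fin m → Fin m → Set
Resolves G u v a b c d =
  Edge G u v × InM G u v a × InM G u v b × InM G v u c × InM G v u d

InInfo : ∀ {n m} → LGraph n m → Fin m → Fin m → Fin m → Fin m → Set
InInfo G a b c d = ∃[ u ] ∃[ v ] Resolves G u v a b c d

SameInfo : ∀ {n m} → LGraph n m → LGraph n m → Set
SameInfo {m = m} G H = ∀ (a b c d : Fin m) → Distinct4 a b c d →
  (InInfo G a b c d ⇔ InInfo H a b c d)

-- Prune(v): delete the leaf v; its neighbour is suppressed (deleted and
-- its two remaining neighbours joined) if it would get degree two,
-- i.e. if it has degree three in G.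
prune : ∀ {n m} → LGraph n m → Fin n → LGraph n m
prune {n} G v = record { adj = adj' ; lab = lab G }
  where
  supp : Fin n → Bool
  supp a = adj G v a ∧ (deg G a ≡ᵇ 3)
  removed : Fin n → Bool
  removed a = (a =ᶠ v) ∨ supp a
  adj' : Fin n → Fin n → Bool
  adj' a b = not (removed a) ∧ not (removed b) ∧
    (adj G a b ∨
      (not (a =ᶠ b) ∧ any (λ w → supp w ∧ adj G a w ∧ adj G w b) (allFin n)))

contract : ∀ {n m} → LGraph n m → Fin n → Fin n → LGraph n m
contract {n} G u v = record { adj = adj' ; lab = lab G }
  where
  adj' : Fin n → Fin n → Bool
  adj' a b = not (a =ᶠ v) ∧ not (b =ᶠ v) ∧
    (adj G a b
      ∨ ((a =ᶠ u) ∧ adj G v b ∧ not (b =ᶠ u))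
      ∨ ((b =ᶠ u) ∧ adj G a v ∧ not (a =ᶠ u)))

record MULTree (n m : ℕ) : Set where
  field
    graph      : LGraph n m
    symmetric  : ∀ u v → Edge graph u v → Edge graph v u
    irreflexive : ∀ u → ¬ Edge graph u u
    connected  : ∀ x y → Walk (Edge graph) x y
    -- acyclic: every edge is a bridge
    acyclic    : ∀ u v → Edge graph u v → ¬ InSub graph u v v
    internalDeg : ∀ v → ¬ IsLeaf graph v → 3 ≤ deg graph v
    surjective : ∀ (ℓ : Fin m) → ∃[ w ] (IsLeaf graph w × lab graph w ≡ ℓ)
open MULTree public

InternalEdge : ∀ {n m} → MULTree n m → Fin n → Fin n → Set
InternalEdge T u v = Edge (graph T) u v × ¬ IsLeaf (graph T) u × ¬ IsLeaf (graph T) v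

Prunable : ∀ {n m} → MULTree n m → Fin n → Set
Prunable T v = IsLeaf (graph T) v × SameInfo (graph T) (prune (graph T) v)

Contractible : ∀ {n m} → MULTree n m → Fin n → Fin n → Set
Contractible T u v = InternalEdge T u v × SameInfo (graph T) (contract (graph T) u v)

MaximallyReduced : ∀ {n m} → MULTree n m → Set
MaximallyReduced T = (∀ v → ¬ Prunable T v) × (∀ u v → ¬ Contractible T u v)

-- Contrapositive: if every quartet resolved by the internal edge uv were also resolved by
-- some other edge, contracting uv would not change the information content.  Contraction
-- merges v into u; since T is a tree, no vertex is adjacent to both u and v, so the merge is
-- injective on the remaining edges.  Hence every edge xy ≠ uv survives with the same leaves,
-- and therefore the same label sets, on both of its sides, and resolves the same quartets.
-- As every notion involved is decidable, the search for a uniquely resolved quartet either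
-- succeeds or certifies that uv is contractible.
module Submission where

open import Data.Nat using (ℕ; zero; suc; _+_; _≤_; _≤?_; z≤n; s≤s)
open import Data.Nat.Properties using (≤-reflexive; ≤-trans; ≤⇒≯; m≤n+m)
open import Data.Bool using (Bool; true; false; T; not; _∧_; _∨_; if_then_else_)
import Data.Bool as Bool
open import Data.Bool.Properties using (T-≡; T-∧; T-∨)
open import Data.Fin using (Fin; zero; suc; _≟_; punchIn; punchOut)
open import Data.Fin.Properties using (any?; 0≢1+n; suc-injective; punchIn-punchOut; punchInᵢ≢i)
open import Data.List using (tabulate)
open import Data.List.Properties using (map-tabulate)
open import Data.Nat.ListAction using (sum)
open import Data.Product using (∃; ∃-syntax; _×_; _,_; proj₁; proj₂; uncurry)
open import Data.Product.Function.NonDependent.Propositional using (_×-⇔_)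
open import Data.Sum using (_⊎_; inj₁; inj₂)
open import Data.Sum.Function.Propositional using (_⊎-⇔_)
open import Data.Empty using (⊥; ⊥-elim)
open import Function using (_∘_; id; const)
open import Function.Bundles using (_⇔_; mk⇔; Equivalence)
open import Function.Properties.Equivalence using () renaming (trans to ⇔-trans; sym to ⇔-sym)
open import Function.Related.TypeIsomorphisms using (¬-cong-⇔)
open import Relation.Binary.Definitions using (Decidable)
open import Relation.Binary.PropositionalEquality using (_≡_; _≢_; refl; sym; trans; cong; subst)
open import Relation.Nullary using (¬_; Dec; yes; no)
open import Relation.Nullary.Decidable using (⌊_⌋; ¬?; _×-dec_; toWitness; fromWitness; toWitnessFalse; fromWitnessFalse; decidable-stable)
import Relation.Nullary.Decidable as Dec
open import Defs

open Equivalence using (to; from)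

trueCount : ∀ {n} → (Fin n → Bool) → ℕ
trueCount {n} f = sum (tabulate {n = n} λ i → if f i then 1 else 0)

AtMostOneTrue : ∀ {n} → (Fin n → Bool) → Set
AtMostOneTrue f = ∀ {i j} → f i ≡ true → f j ≡ true → i ≡ j

trueCount-head : ∀ {n} (f : Fin (suc n) → Bool) → f zero ≡ true →
                 trueCount f ≡ suc (trueCount (f ∘ suc))
trueCount-head f f₀ = cong (λ b → (if b then 1 else 0) + trueCount (f ∘ suc)) f₀

trueCount-pos : ∀ {n} (f : Fin n → Bool) {i} → f i ≡ true → 1 ≤ trueCount f
trueCount-pos f {zero}  fᵢ rewrite trueCount-head f fᵢ = s≤s z≤n
trueCount-pos f {suc i} fᵢ = ≤-trans (trueCount-pos (f ∘ suc) fᵢ) (m≤n+m _ _)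

trueCount-none : ∀ {n} (f : Fin n → Bool) → (∀ i → f i ≢ true) → trueCount f ≡ 0
trueCount-none {zero}  f none = refl
trueCount-none {suc n} f none with f zero in f₀
... | true  = ⊥-elim (none zero f₀)
... | false = trueCount-none (f ∘ suc) (none ∘ suc)

trueCount-two : ∀ {n} (f : Fin (suc n) → Bool) {j} → f zero ≡ true → f (suc j) ≡ true →
                ¬ trueCount f ≤ 1
trueCount-two f f₀ fⱼ c rewrite trueCount-head f f₀ = ≤⇒≯ c (s≤s (trueCount-pos (f ∘ suc) fⱼ))

trueCount≤1⇒atMostOneTrue : ∀ {n} (f : Fin n → Bool) → trueCount f ≤ 1 → AtMostOneTrue f
trueCount≤1⇒atMostOneTrue f c {zero}  {zero}  _  _  = refl
trueCount≤1⇒atMostOneTrue f c {zero}  {suc j} fᵢ fⱼ = ⊥-elim (trueCount-two f fᵢ fⱼ c)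
trueCount≤1⇒atMostOneTrue f c {suc i} {zero}  fᵢ fⱼ = ⊥-elim (trueCount-two f fⱼ fᵢ c)
trueCount≤1⇒atMostOneTrue f c {suc i} {suc j} fᵢ fⱼ =
  cong suc (trueCount≤1⇒atMostOneTrue (f ∘ suc) (≤-trans (m≤n+m _ _) c) fᵢ fⱼ)

atMostOneTrue⇒trueCount≤1 : ∀ {n} (f : Fin n → Bool) → AtMostOneTrue f → trueCount f ≤ 1
atMostOneTrue⇒trueCount≤1 {zero}  f _ = z≤n
atMostOneTrue⇒trueCount≤1 {suc n} f unique with f zero in f₀
... | true  = s≤s (≤-reflexive (trueCount-none (f ∘ suc) λ i fᵢ → 0≢1+n (unique f₀ fᵢ)))
... | false = atMostOneTrue⇒trueCount≤1 (f ∘ suc) λ fᵢ fⱼ → suc-injective (unique fᵢ fⱼ)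

walk? : ∀ {n} {E : Fin n → Fin n → Set} → Decidable E → Decidable (Walk E)
walk? {zero} _ ()
walk? {suc n} {E} E? x y with x ≟ y
... | yes refl = yes here
... | no x≢y = subst (Dec ∘ Walk E x) (punchIn-punchOut x≢y)
  (Dec.map (⇔-sym walkFrom⇔)
    (any? λ i → E? x (punchIn x i) ×-dec walk? (λ i j → E? (punchIn x i) (punchIn x j)) i (punchOut x≢y)))
  where
  Avoiding : Fin n → Fin n → Set
  Avoiding i j = E (punchIn x i) (punchIn x j)

  unpunch : ∀ {i j} → Walk Avoiding i j → Walk E (punchIn x i) (punchIn x j)
  unpunch here       = here
  unpunch (step e w) = step e (unpunch w)

  -- Split a walk into y = punchIn x j at its last departure from x.
  lastDeparture : ∀ {a j} → Walk E a (punchIn x j) →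
    (∃[ i ] punchIn x i ≡ a × Walk Avoiding i j) ⊎ (∃[ i ] E x (punchIn x i) × Walk Avoiding i j)
  lastDeparture here = inj₁ (_ , refl , here)
  lastDeparture (step {a} e w) with lastDeparture w
  ... | inj₂ departure = inj₂ departure
  ... | inj₁ (i , refl , w′) with x ≟ a
  ...   | yes refl = inj₂ (i , e , w′)
  ...   | no x≢a   = inj₁ (punchOut x≢a , punchIn-punchOut x≢a ,
                           step (subst (λ b → E b _) (sym (punchIn-punchOut x≢a)) e) w′)

  walkFrom⇔ : ∀ {j} → Walk E x (punchIn x j) ⇔ (∃[ i ] E x (punchIn x i) × Walk Avoiding i j)
  walkFrom⇔ = mk⇔ departure (λ (i , e , w) → step e (unpunch w))
    where
    departure : ∀ {j} → Walk E x (punchIn x j) → ∃[ i ] E x (punchIn x i) × Walk Avoiding i j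
    departure w with lastDeparture w
    ... | inj₁ (i , i≡x , _) = ⊥-elim (punchInᵢ≢i x i i≡x)
    ... | inj₂ d = d

distinct4? : ∀ {m} (a b c d : Fin m) → Dec (Distinct4 a b c d)
distinct4? a b c d =
  ¬? (a ≟ b) ×-dec ¬? (a ≟ c) ×-dec ¬? (a ≟ d) ×-dec ¬? (b ≟ c) ×-dec ¬? (b ≟ d) ×-dec ¬? (c ≟ d)

distinct4-swap : ∀ {m} {a b c d : Fin m} → Distinct4 a b c d → Distinct4 c d a b
distinct4-swap (a≢b , a≢c , a≢d , b≢c , b≢d , c≢d) =
  c≢d , a≢c ∘ sym , b≢c ∘ sym , a≢d ∘ sym , b≢d ∘ sym , a≢b

module _ {n m} (G : LGraph n m) where

  deg≡trueCount : ∀ w → deg G w ≡ trueCount (adj G w)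
  deg≡trueCount w = cong sum (map-tabulate id λ z → if adj G w z then 1 else 0)

  isLeaf⇔atMostOneNeighbour : ∀ {w} → IsLeaf G w ⇔ AtMostOneTrue (adj G w)
  isLeaf⇔atMostOneNeighbour {w} = mk⇔
    (trueCount≤1⇒atMostOneTrue (adj G w) ∘ subst (_≤ 1) (deg≡trueCount w))
    (subst (_≤ 1) (sym (deg≡trueCount w)) ∘ atMostOneTrue⇒trueCount≤1 (adj G w))

  edge? : Decidable (Edge G)
  edge? a b = adj G a b Bool.≟ true

  isLeaf? : ∀ w → Dec (IsLeaf G w)
  isLeaf? w = deg G w ≤? 1

  nonLeaf⇒neighbourOtherThan : ∀ {w} → ¬ IsLeaf G w → ∀ x → ∃[ z ] Edge G w z × z ≢ x
  nonLeaf⇒neighbourOtherThan {w} nonLeaf x with any? (λ z → edge? w z ×-dec ¬? (z ≟ x))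
  ... | yes found = found
  ... | no none = ⊥-elim (nonLeaf (from isLeaf⇔atMostOneNeighbour λ eᵢ eⱼ → trans (onlyX eᵢ) (sym (onlyX eⱼ))))
    where
    onlyX : ∀ {z} → Edge G w z → z ≡ x
    onlyX {z} e = decidable-stable (z ≟ x) λ z≢x → none (z , e , z≢x)

  edgeWithout? : ∀ x y → Decidable (EdgeWithout G x y)
  edgeWithout? x y a b = edge? a b ×-dec ¬? (a ≟ x ×-dec b ≟ y) ×-dec ¬? (a ≟ y ×-dec b ≟ x)

  labelIn? : ∀ x y ℓ → Dec (LabelIn G x y ℓ)
  labelIn? x y ℓ = any? λ w → walk? (edgeWithout? x y) x w ×-dec isLeaf? w ×-dec lab G w ≟ ℓ

  inM? : ∀ x y ℓ → Dec (InM G x y ℓ)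
  inM? x y ℓ = labelIn? x y ℓ ×-dec ¬? (labelIn? y x ℓ)

  resolves? : ∀ x y a b c d → Dec (Resolves G x y a b c d)
  resolves? x y a b c d = edge? x y ×-dec inM? x y a ×-dec inM? x y b ×-dec inM? y x c ×-dec inM? y x d

T-⌊⌋ : ∀ {A : Set} (A? : Dec A) → T ⌊ A? ⌋ ⇔ A
T-⌊⌋ _ = mk⇔ toWitness fromWitness

T-not-⌊⌋ : ∀ {A : Set} (A? : Dec A) → T (not ⌊ A? ⌋) ⇔ (¬ A)
T-not-⌊⌋ _ = mk⇔ toWitnessFalse fromWitnessFalse

ContractedEdge : ∀ {n m} → LGraph n m → Fin n → Fin n → Fin n → Fin n → Set
ContractedEdge G u v a b = a ≢ v × b ≢ v ×
  (Edge G a b ⊎ (a ≡ u × Edge G v b × b ≢ u) ⊎ (b ≡ u × Edge G a v × a ≢ u))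

contract-edge⇔ : ∀ {n m} (G : LGraph n m) u v {a b} →
                 Edge (contract G u v) a b ⇔ ContractedEdge G u v a b
contract-edge⇔ G u v {a} {b} = ⇔-trans (⇔-sym T-≡)
  (both (T-not-⌊⌋ (a ≟ v)) (both (T-not-⌊⌋ (b ≟ v)) (either T-≡
    (either (both (T-⌊⌋ (a ≟ u)) (both T-≡ (T-not-⌊⌋ (b ≟ u))))
            (both (T-⌊⌋ (b ≟ u)) (both T-≡ (T-not-⌊⌋ (a ≟ u))))))))
  where
  both : ∀ {x y} {A B : Set} → T x ⇔ A → T y ⇔ B → T (x ∧ y) ⇔ (A × B)
  both p q = ⇔-trans T-∧ (p ×-⇔ q)
  either : ∀ {x y} {A B : Set} → T x ⇔ A → T y ⇔ B → T (x ∨ y) ⇔ (A ⊎ B)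
  either p q = ⇔-trans T-∨ (p ⊎-⇔ q)

module Contraction {n m} (T : MULTree n m) {u v : Fin n} (uv : Edge (graph T) u v) where

  G G′ : LGraph n m
  G  = graph T
  G′ = contract G u v

  OtherEdge : Fin n → Fin n → Set
  OtherEdge = EdgeWithout G u v

  edge-sym : ∀ {a b} → Edge G a b → Edge G b a
  edge-sym = symmetric T _ _

  edge⇒≢ : ∀ {a b} → Edge G a b → a ≢ b
  edge⇒≢ e refl = irreflexive T _ e

  u≢v : u ≢ v
  u≢v = edge⇒≢ uv

  otherEdge-sym : ∀ {a b} → OtherEdge a b → OtherEdge b a
  otherEdge-sym (e , ¬uv , ¬vu) = edge-sym e , (λ (p , q) → ¬vu (q , p)) , (λ (p , q) → ¬uv (q , p))

  edge-uv⊎other : ∀ {a b} → Edge G a b → ((a ≡ u × b ≡ v) ⊎ (a ≡ v × b ≡ u)) ⊎ OtherEdge a b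
  edge-uv⊎other {a} {b} e with a ≟ u ×-dec b ≟ v | a ≟ v ×-dec b ≟ u
  ... | yes p | _     = inj₁ (inj₁ p)
  ... | no _  | yes q = inj₁ (inj₂ q)
  ... | no ¬p | no ¬q = inj₂ (e , ¬p , ¬q)

  noCommonNeighbour : ∀ {z} → Edge G z u → Edge G z v → ⊥
  noCommonNeighbour {z} zu zv = acyclic T z u zu
    (step (zv , u≢v ∘ sym ∘ proj₂ , edge⇒≢ zu ∘ proj₁)
      (step (edge-sym uv , edge⇒≢ zv ∘ sym ∘ proj₁ , u≢v ∘ sym ∘ proj₁) here))

  merge : Fin n → Fin n
  merge x with x ≟ v
  ... | yes _ = u
  ... | no  _ = x

  merge-v : merge v ≡ u
  merge-v with v ≟ v
  ... | yes _   = refl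
  ... | no  v≢v = ⊥-elim (v≢v refl)

  merge-≢v : ∀ {x} → x ≢ v → merge x ≡ x
  merge-≢v {x} x≢v with x ≟ v
  ... | yes x≡v = ⊥-elim (x≢v x≡v)
  ... | no  _   = refl

  merge-u : merge u ≡ u
  merge-u = merge-≢v u≢v

  merge-reflects : ∀ {a w} → merge a ≡ w → w ≢ u → a ≡ w
  merge-reflects {a} ma w≢u with a ≟ v
  ... | yes _ = ⊥-elim (w≢u (sym ma))
  ... | no  _ = ma

  merge-collision : ∀ {a b} → merge a ≡ merge b → a ≡ b ⊎ (a ≡ u × b ≡ v) ⊎ (a ≡ v × b ≡ u)
  merge-collision {a} {b} eq with a ≟ v | b ≟ v
  ... | yes a≡v | yes b≡v = inj₁ (trans a≡v (sym b≡v))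
  ... | yes a≡v | no  _   = inj₂ (inj₂ (a≡v , sym eq))
  ... | no  _   | yes b≡v = inj₂ (inj₁ (eq , b≡v))
  ... | no  _   | no  _   = inj₁ eq

  merge-edge : ∀ {a b} → OtherEdge a b → Edge G′ (merge a) (merge b)
  merge-edge {a} {b} (e , ¬uv , ¬vu) with a ≟ v | b ≟ v
  ... | yes refl | yes refl = ⊥-elim (edge⇒≢ e refl)
  ... | yes refl | no b≢v   = from (contract-edge⇔ G u v) (u≢v , b≢v , inj₂ (inj₁ (refl , e , λ b≡u → ¬vu (refl , b≡u))))
  ... | no a≢v   | yes refl = from (contract-edge⇔ G u v) (a≢v , u≢v , inj₂ (inj₂ (refl , e , λ a≡u → ¬uv (a≡u , refl))))
  ... | no a≢v   | no b≢v   = from (contract-edge⇔ G u v) (a≢v , b≢v , inj₁ e)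

  unmerge-edge : ∀ {a′ b′} → Edge G′ a′ b′ → ∃[ a ] ∃[ b ] OtherEdge a b × merge a ≡ a′ × merge b ≡ b′
  unmerge-edge e with to (contract-edge⇔ G u v) e
  ... | a≢v , b≢v , inj₁ ab = _ , _ , (ab , b≢v ∘ proj₂ , a≢v ∘ proj₁) , merge-≢v a≢v , merge-≢v b≢v
  ... | _ , b≢v , inj₂ (inj₁ (refl , vb , b≢u)) =
        v , _ , (vb , u≢v ∘ sym ∘ proj₁ , b≢u ∘ proj₂) , merge-v , merge-≢v b≢v
  ... | a≢v , _ , inj₂ (inj₂ (refl , av , a≢u)) =
        _ , v , (av , a≢u ∘ proj₁ , a≢v ∘ proj₁) , merge-≢v a≢v , merge-v

  -- A collision of merged endpoints off the edge uv would give u and v a common neighbour.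
  merge-injectiveOnEdges : ∀ {a b a′ b′} → OtherEdge a b → OtherEdge a′ b′ →
                           merge a ≡ merge a′ → merge b ≡ merge b′ → a ≡ a′ × b ≡ b′
  merge-injectiveOnEdges (e , ¬uv , ¬vu) (e′ , _) p q with merge-collision p | merge-collision q
  ... | inj₁ a≡a′ | inj₁ b≡b′ = a≡a′ , b≡b′
  ... | inj₁ refl | inj₂ (inj₁ (refl , refl)) = ⊥-elim (noCommonNeighbour e e′)
  ... | inj₁ refl | inj₂ (inj₂ (refl , refl)) = ⊥-elim (noCommonNeighbour e′ e)
  ... | inj₂ (inj₁ (refl , refl)) | inj₁ refl = ⊥-elim (noCommonNeighbour (edge-sym e) (edge-sym e′))
  ... | inj₂ (inj₂ (refl , refl)) | inj₁ refl = ⊥-elim (noCommonNeighbour (edge-sym e′) (edge-sym e))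
  ... | inj₂ (inj₁ (refl , refl)) | inj₂ (inj₁ (refl , _)) = ⊥-elim (edge⇒≢ e refl)
  ... | inj₂ (inj₁ (refl , refl)) | inj₂ (inj₂ (refl , _)) = ⊥-elim (¬uv (refl , refl))
  ... | inj₂ (inj₂ (refl , refl)) | inj₂ (inj₁ (refl , _)) = ⊥-elim (¬vu (refl , refl))
  ... | inj₂ (inj₂ (refl , refl)) | inj₂ (inj₂ (refl , _)) = ⊥-elim (edge⇒≢ e refl)

  module _ {x y} (xy : OtherEdge x y) where

    Walk′ : Fin n → Fin n → Set
    Walk′ = Walk (EdgeWithout G′ (merge x) (merge y))

    merge-walk : ∀ {a w} → Walk (EdgeWithout G x y) a w → Walk′ (merge a) (merge w)
    merge-walk here = here
    merge-walk {w = w} (step (e , ¬xy , ¬yx) rest) with edge-uv⊎other e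
    ... | inj₁ (inj₁ (refl , refl)) = subst (λ c → Walk′ c (merge w)) (trans merge-v (sym merge-u)) (merge-walk rest)
    ... | inj₁ (inj₂ (refl , refl)) = subst (λ c → Walk′ c (merge w)) (trans merge-u (sym merge-v)) (merge-walk rest)
    ... | inj₂ ab = step (merge-edge ab , ¬xy ∘ uncurry (merge-injectiveOnEdges ab xy)
                                        , ¬yx ∘ uncurry (merge-injectiveOnEdges ab (otherEdge-sym xy)))
                         (merge-walk rest)

    uvWithout : EdgeWithout G x y u v
    uvWithout = uv , (λ (p , q) → proj₁ (proj₂ xy) (sym p , sym q))
                   , (λ (p , q) → proj₂ (proj₂ xy) (sym q , sym p))

    vuWithout : EdgeWithout G x y v u
    vuWithout = edge-sym uv , (λ (p , q) → proj₂ (proj₂ xy) (sym p , sym q))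
                            , (λ (p , q) → proj₁ (proj₂ xy) (sym q , sym p))

    unmerge-walk : ∀ {c w′} → Walk′ (merge c) w′ →
                   ∃[ w ] Walk (EdgeWithout G x y) c w × merge w ≡ w′
    unmerge-walk here = _ , here , refl
    unmerge-walk {c} (step {y = b′} (e′ , ¬xy′ , ¬yx′) rest) with unmerge-edge {b′ = b′} e′
    ... | a , b , (ab , _) , ma , refl with unmerge-walk rest
    ... | w , walk , mw = w , from-c (merge-collision (sym ma)) , mw
      where
      abWithout : EdgeWithout G x y a b
      abWithout = ab , (λ (p , q) → ¬xy′ (trans (sym ma) (cong merge p) , cong merge q))
                     , (λ (p , q) → ¬yx′ (trans (sym ma) (cong merge p) , cong merge q))
      from-c : c ≡ a ⊎ (c ≡ u × a ≡ v) ⊎ (c ≡ v × a ≡ u) → Walk (EdgeWithout G x y) c w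
      from-c (inj₁ refl)                 = step abWithout walk
      from-c (inj₂ (inj₁ (refl , refl))) = step uvWithout (step abWithout walk)
      from-c (inj₂ (inj₂ (refl , refl))) = step vuWithout (step abWithout walk)

  otherEdge-at : ∀ {w c} → w ≢ u → w ≢ v → Edge G w c → OtherEdge w c
  otherEdge-at w≢u w≢v e = e , w≢u ∘ proj₁ , w≢v ∘ proj₁

  isLeaf-contract⇔ : ∀ {w} → w ≢ u → w ≢ v → IsLeaf G w ⇔ IsLeaf G′ w
  isLeaf-contract⇔ {w} w≢u w≢v = mk⇔ leaf→leaf′ leaf′→leaf
    where
    neighbour : ∀ {b} → Edge G′ w b → ∃[ c ] Edge G w c × merge c ≡ b
    neighbour {b} e′ with unmerge-edge {w} {b} e′
    ... | a , c , (ac , _) , ma , mc = c , subst (λ z → Edge G z c) (merge-reflects ma w≢u) ac , mc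

    leaf→leaf′ : IsLeaf G w → IsLeaf G′ w
    leaf→leaf′ leaf = from (isLeaf⇔atMostOneNeighbour G′ {w}) λ e₁ e₂ → unique (neighbour e₁) (neighbour e₂)
      where
      unique : ∀ {b₁ b₂} → ∃[ c ] Edge G w c × merge c ≡ b₁ → ∃[ c ] Edge G w c × merge c ≡ b₂ → b₁ ≡ b₂
      unique (c₁ , e₁ , refl) (c₂ , e₂ , refl) = cong merge (to (isLeaf⇔atMostOneNeighbour G {w}) leaf e₁ e₂)

    leaf′→leaf : IsLeaf G′ w → IsLeaf G w
    leaf′→leaf leaf′ = from (isLeaf⇔atMostOneNeighbour G {w}) λ e₁ e₂ →
      proj₂ (merge-injectiveOnEdges (otherEdge-at w≢u w≢v e₁) (otherEdge-at w≢u w≢v e₂) refl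
        (to (isLeaf⇔atMostOneNeighbour G′ {w}) leaf′ (merged e₁) (merged e₂)))
      where
      merged : ∀ {c} → Edge G w c → Edge G′ w (merge c)
      merged e = subst (λ z → Edge G′ z _) (merge-≢v w≢v) (merge-edge (otherEdge-at w≢u w≢v e))

  resolves-swap : ∀ {x y a b c d} → Resolves G x y a b c d → Resolves G y x c d a b
  resolves-swap (e , A , B , C , D) = edge-sym e , C , D , A , B

  ResolvedElsewhere : Fin m → Fin m → Fin m → Fin m → Set
  ResolvedElsewhere a b c d = ∃[ x ] ∃[ y ] OtherEdge x y × Resolves G x y a b c d

  resolvedElsewhere-swap : ∀ {a b c d} → ResolvedElsewhere a b c d → ResolvedElsewhere c d a b
  resolvedElsewhere-swap (x , y , xy , r) = y , x , otherEdge-sym xy , resolves-swap r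

  resolvedElsewhere? : ∀ a b c d → Dec (ResolvedElsewhere a b c d)
  resolvedElsewhere? a b c d = any? λ x → any? λ y → edgeWithout? G u v x y ×-dec resolves? G x y a b c d

  module _ (u-nonLeaf : ¬ IsLeaf G u) (v-nonLeaf : ¬ IsLeaf G v) where

    u-nonLeaf′ : ¬ IsLeaf G′ u
    u-nonLeaf′ leaf′ with nonLeaf⇒neighbourOtherThan G u-nonLeaf v | nonLeaf⇒neighbourOtherThan G v-nonLeaf u
    ... | z₁ , uz₁ , z₁≢v | z₂ , vz₂ , z₂≢u =
      u≢v (proj₁ (merge-injectiveOnEdges uz₁′ vz₂′ (trans merge-u (sym merge-v))
        (to (isLeaf⇔atMostOneNeighbour G′ {u}) leaf′
          (subst (λ z → Edge G′ z (merge z₁)) merge-u (merge-edge uz₁′))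
          (subst (λ z → Edge G′ z (merge z₂)) merge-v (merge-edge vz₂′)))))
      where
      uz₁′ : OtherEdge u z₁
      uz₁′ = uz₁ , z₁≢v ∘ proj₂ , u≢v ∘ proj₁
      vz₂′ : OtherEdge v z₂
      vz₂′ = vz₂ , u≢v ∘ sym ∘ proj₁ , z₂≢u ∘ proj₂

    labelIn-contract⇔ : ∀ {x y ℓ} → OtherEdge x y → LabelIn G x y ℓ ⇔ LabelIn G′ (merge x) (merge y) ℓ
    labelIn-contract⇔ {x} {y} {ℓ} xy = mk⇔ forward backward
      where
      forward : LabelIn G x y ℓ → LabelIn G′ (merge x) (merge y) ℓ
      forward (w , walk , leaf , lw) =
        w , subst (InSub G′ (merge x) (merge y)) (merge-≢v w≢v) (merge-walk xy walk) ,
        to (isLeaf-contract⇔ w≢u w≢v) leaf , lw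
        where
        w≢u : w ≢ u
        w≢u refl = u-nonLeaf leaf
        w≢v : w ≢ v
        w≢v refl = v-nonLeaf leaf

      backward : LabelIn G′ (merge x) (merge y) ℓ → LabelIn G x y ℓ
      backward (w′ , walk′ , leaf′ , lw′) with unmerge-walk xy walk′
      ... | w , walk , refl = w , walk , from (isLeaf-contract⇔ w≢u w≢v) (subst (IsLeaf G′) (sym w≡mw) leaf′) ,
                              subst (λ z → lab G z ≡ ℓ) (sym w≡mw) lw′
        where
        mw≢u : merge w ≢ u
        mw≢u mw≡u = u-nonLeaf′ (subst (IsLeaf G′) mw≡u leaf′)
        w≡mw : w ≡ merge w
        w≡mw = merge-reflects refl mw≢u
        w≢u : w ≢ u
        w≢u refl = mw≢u merge-u
        w≢v : w ≢ v
        w≢v refl = mw≢u merge-v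

    resolves-contract⇔ : ∀ {x y a b c d} → OtherEdge x y →
      Resolves G x y a b c d ⇔ Resolves G′ (merge x) (merge y) a b c d
    resolves-contract⇔ xy = mk⇔ (const (merge-edge xy)) (const (proj₁ xy))
      ×-⇔ inM-contract⇔ xy ×-⇔ inM-contract⇔ xy ×-⇔ inM-contract⇔ yx ×-⇔ inM-contract⇔ yx
      where
      yx = otherEdge-sym xy
      inM-contract⇔ : ∀ {x y ℓ} → OtherEdge x y → InM G x y ℓ ⇔ InM G′ (merge x) (merge y) ℓ
      inM-contract⇔ xy = labelIn-contract⇔ xy ×-⇔ ¬-cong-⇔ (labelIn-contract⇔ (otherEdge-sym xy))

    contract-sameInfo : (∀ a b c d → Distinct4 a b c d → Resolves G u v a b c d → ResolvedElsewhere a b c d) →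
                        SameInfo G G′
    contract-sameInfo elsewhere a b c d distinct = mk⇔ forward backward
      where
      transfer : ∀ {a b c d} → ResolvedElsewhere a b c d → InInfo G′ a b c d
      transfer (x , y , xy , r) = merge x , merge y , to (resolves-contract⇔ xy) r

      forward : InInfo G a b c d → InInfo G′ a b c d
      forward (x , y , r) with edge-uv⊎other (proj₁ r)
      ... | inj₁ (inj₁ (refl , refl)) = transfer (elsewhere a b c d distinct r)
      ... | inj₁ (inj₂ (refl , refl)) =
        transfer (resolvedElsewhere-swap (elsewhere c d a b (distinct4-swap distinct) (resolves-swap r)))
      ... | inj₂ xy = transfer (x , y , xy , r)

      backward : InInfo G′ a b c d → InInfo G a b c d
      backward (x′ , y′ , r′) with unmerge-edge {x′} {y′} (proj₁ r′)
      ... | x , y , xy , refl , refl = x , y , from (resolves-contract⇔ xy) r′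

    uniquelyResolved⊎sameInfo :
      (∃[ a ] ∃[ b ] ∃[ c ] ∃[ d ] Distinct4 a b c d × Resolves G u v a b c d × ¬ ResolvedElsewhere a b c d)
      ⊎ SameInfo G G′
    uniquelyResolved⊎sameInfo with any? (λ a → any? λ b → any? λ c → any? λ d →
      distinct4? a b c d ×-dec resolves? G u v a b c d ×-dec ¬? (resolvedElsewhere? a b c d))
    ... | yes quartet = inj₁ quartet
    ... | no none = inj₂ (contract-sameInfo λ a b c d distinct r →
      decidable-stable (resolvedElsewhere? a b c d) λ ¬elsewhere → none (a , b , c , d , distinct , r , ¬elsewhere))

theorem2 : ∀ {n m} (T : MULTree n m) → MaximallyReduced T →
    ∀ u v → InternalEdge T u v →
    ∃[ a ] ∃[ b ] ∃[ c ] ∃[ d ] (Distinct4 a b c d ×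
      Resolves (graph T) u v a b c d ×
      (∀ x y → Resolves (graph T) x y a b c d →
        (x ≡ u × y ≡ v) ⊎ (x ≡ v × y ≡ u)))
theorem2 T (_ , notContractible) u v internal@(uv , u-nonLeaf , v-nonLeaf)
  with Contraction.uniquelyResolved⊎sameInfo T uv u-nonLeaf v-nonLeaf
... | inj₂ sameInfo = ⊥-elim (notContractible u v (internal , sameInfo))
... | inj₁ (a , b , c , d , distinct , r , unique) = a , b , c , d , distinct , r , onlyUV
  where
  open Contraction T uv using (edge-uv⊎other)
  onlyUV : ∀ x y → Resolves (graph T) x y a b c d → (x ≡ u × y ≡ v) ⊎ (x ≡ v × y ≡ u)
  onlyUV x y r′ with edge-uv⊎other (proj₁ r′)
  ... | inj₁ isUV = isUV
  ... | inj₂ xy = ⊥-elim (unique (x , y , xy , r′))
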